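{- Let $\mathfrak{v}, \mathfrak{v}'$ be language valuations such that for every variable $x$, $\mathrm{I} \in \mathfrak{v}(x)$ iff $\mathrm{I} \in \mathfrak{v}'(x)$. Then for all terms $t$, $\mathrm{I} \in \hat{\mathfrak{v}}(t)$ iff $\mathrm{I} \in \hat{\mathfrak{v}}'(t)$.
   Context: Let $\mathbf{V}$ be a set of variables. Terms are generated by $t, s ::= x \mid \mathrm{I} \mid \bot \mid t \cdot s \mid t \cup s \mid t^{*} \mid x^{ - }$ ($x \in \mathbf{V}$). For a set $X$, a language valuation over $X$ is a map $\mathfrak{v}$ from variables to subsets of $X^{*}$ ($\mathrm{I}$ denotes the empty word), extended to terms $\hat{\mathfrak{v}}$ by $\hat{\mathfrak{v}}(\mathrm{I}) = \{\mathrm{I}\}$, $\hat{\mathfrak{v}}(\bot) = \emptyset$, $\hat{\mathfrak{v}}(t\cdot s) = \{ab \mid a \in \hat{\mathfrak{v}}(t), b \in \hat{\mathfrak{v}}(s)\}$, $\hat{\mathfrak{v}}(t \cup s) = \hat{\mathfrak{v}}(t)\cup\hat{\mathfrak{v}}(s)$, $\hat{\mathfrak{v}}(t^{*}) = \hat{\mathfrak{v}}(t)^{*}$, $\hat{\mathfrak{v}}(x^{ - }) = X^{*} \setminus \mathfrak{v}(x)$. The valuations $\mathfrak{v}, \mathfrak{v}'$ may be over different sets. -}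

module Defs where

open import Level using (Level; _⊔_; suc)
open import Data.List using (List; []; _++_)
open import Data.Empty.Polymorphic using (⊥)
open import Data.Product using (Σ; ∃-syntax; _×_; _,_)
open import Data.Sum using (_⊎_)
open import Relation.Binary.PropositionalEquality using (_≡_)
open import Relation.Nullary using (¬_)

data Term {v : Level} (V : Set v) : Set v where
  var  : V → Term V
  one  : Term V
  zer  : Term V
  _·_  : Term V → Term V → Term V
  _∪_  : Term V → Term V → Term V
  _⋆   : Term V → Term V
  _⁻   : V → Term V

Lang : ∀ {a} (X : Set a) → (ℓ : Level) → Set (a ⊔ suc ℓ)
Lang X ℓ = List X → Set ℓ

concat : ∀ {a ℓ} {X : Set a} → Lang X ℓ → Lang X ℓ → Lang X (a ⊔ ℓ)
concat L M w = ∃[ u ] ∃[ u′ ] (L u × M u′ × w ≡ u ++ u′)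

data Star {a ℓ} {X : Set a} (L : Lang X ℓ) : List X → Set (a ⊔ ℓ) where
  nil  : Star L []
  cons : ∀ {u w} → L u → Star L w → Star L (u ++ w)

Valuation : ∀ {v a} (V : Set v) (X : Set a) (ℓ : Level) → Set (v ⊔ a ⊔ suc ℓ)
Valuation V X ℓ = V → Lang X ℓ

⟦_⟧ : ∀ {v a ℓ} {V : Set v} {X : Set a} → Term V → Valuation V X ℓ → Lang X (a ⊔ ℓ)
⟦_⟧ {a = a} {ℓ = ℓ} (var x) 𝔳 w = Level.Lift (a ⊔ ℓ) (𝔳 x w)
⟦_⟧ {a = a} {ℓ = ℓ} one 𝔳 w = Level.Lift (a ⊔ ℓ) (w ≡ [])
⟦ zer ⟧ 𝔳 w = ⊥
⟦ t · s ⟧ 𝔳 = concat (⟦ t ⟧ 𝔳) (⟦ s ⟧ 𝔳)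
⟦ t ∪ s ⟧ 𝔳 w = ⟦ t ⟧ 𝔳 w ⊎ ⟦ s ⟧ 𝔳 w
⟦ t ⋆ ⟧ 𝔳 = Star (⟦ t ⟧ 𝔳)
⟦_⟧ {a = a} {ℓ = ℓ} (x ⁻) 𝔳 w = Level.Lift (a ⊔ ℓ) (¬ 𝔳 x w)

{-# OPTIONS --safe #-}
module Submission where

-- Whether the empty word lies in a term's language is computed compositionally
-- from the same information for the variables: I ∈ t·s iff I ∈ t and I ∈ s,
-- I ∈ t ∪ s iff I ∈ t or I ∈ s, I ∈ t* always, and I ∈ x⁻ iff I ∉ x.

open import Defs
open import Level using (Level; Lift; lift; lower)
open import Data.List using ([])
open import Data.List.Properties using (++-conicalˡ; ++-conicalʳ)
open import Data.Product using (_×_; _,_)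
open import Data.Product.Function.NonDependent.Propositional using (_×-⇔_)
open import Data.Sum.Function.Propositional using (_⊎-⇔_)
open import Function.Bundles using (_⇔_; mk⇔; Equivalence)
open import Function.Construct.Composition using (_⇔-∘_)
open import Function.Construct.Symmetry using (⇔-sym)
open import Function.Related.TypeIsomorphisms using (¬-cong-⇔)
open import Relation.Binary.PropositionalEquality using (refl; sym; subst)

private
  variable
    a ℓ ℓ′ : Level
    A B : Set a
    X Y : Set a

Lift-cong-⇔ : A ⇔ B → Lift ℓ A ⇔ Lift ℓ′ B
Lift-cong-⇔ A⇔B = mk⇔ (λ p → lift (Equivalence.to A⇔B (lower p)))
                      (λ p → lift (Equivalence.from A⇔B (lower p)))

concat-[]-⇔ : (L M : Lang X ℓ) → concat L M [] ⇔ (L [] × M [])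
concat-[]-⇔ L M = mk⇔ to (λ (p , q) → [] , [] , p , q , refl)
  where
  to : concat L M [] → L [] × M []
  to (u , u′ , p , q , []≡u++u′) =
    subst L (++-conicalˡ u u′ (sym []≡u++u′)) p , subst M (++-conicalʳ u u′ (sym []≡u++u′)) q

Star-[]-⇔ : (L : Lang X ℓ) (M : Lang Y ℓ′) → Star L [] ⇔ Star M []
Star-[]-⇔ L M = mk⇔ (λ _ → nil) (λ _ → nil)

lemma3p2 : ∀ {v a b ℓ ℓ′} {V : Set v} {X : Set a} {Y : Set b}
           (𝔳 : Valuation V X ℓ) (𝔳′ : Valuation V Y ℓ′) →
           (∀ x → 𝔳 x [] ⇔ 𝔳′ x []) →
           ∀ (t : Term V) → ⟦ t ⟧ 𝔳 [] ⇔ ⟦ t ⟧ 𝔳′ []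
lemma3p2 𝔳 𝔳′ I∈x⇔ = I∈⇔
  where
  I∈⇔ : ∀ t → ⟦ t ⟧ 𝔳 [] ⇔ ⟦ t ⟧ 𝔳′ []
  I∈⇔ (var x) = Lift-cong-⇔ (I∈x⇔ x)
  I∈⇔ one     = Lift-cong-⇔ (mk⇔ (λ _ → refl) (λ _ → refl))
  I∈⇔ zer     = mk⇔ (λ ()) (λ ())
  I∈⇔ (t · s) = ⇔-sym (concat-[]-⇔ (⟦ t ⟧ 𝔳′) (⟦ s ⟧ 𝔳′))
           ⇔-∘ ((I∈⇔ t ×-⇔ I∈⇔ s) ⇔-∘ concat-[]-⇔ (⟦ t ⟧ 𝔳) (⟦ s ⟧ 𝔳))
  I∈⇔ (t ∪ s) = I∈⇔ t ⊎-⇔ I∈⇔ s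
  I∈⇔ (t ⋆)   = Star-[]-⇔ (⟦ t ⟧ 𝔳) (⟦ t ⟧ 𝔳′)
  I∈⇔ (x ⁻)   = Lift-cong-⇔ (¬-cong-⇔ (I∈x⇔ x))
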